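{- For all $\alpha,\beta,\gamma\in\vartheta(\varepsilon_{\Omega+1})$ we have $\gamma\in C_\alpha(\beta)$ if and only if $E(\gamma)\subseteq C_\alpha(\beta)$. Moreover, for every $\alpha$, the term $\vartheta\alpha$ is the $\prec$-minimum of the set $\{\gamma\in\vartheta(\varepsilon_{\Omega+1})\mid C_\alpha(\gamma)\cap\Omega\prec^*\gamma\text{ and }\alpha\in C_\alpha(\gamma)\}$, i.e. $\vartheta\alpha$ belongs to this set and $\vartheta\alpha\preceq\gamma$ for every $\gamma$ in it; here $C_\alpha(\gamma)\cap\Omega\prec^*\gamma$ means that $\delta\prec\gamma$ for every $\delta\in C_\alpha(\gamma)$ with $\delta\prec\Omega$.
   Context: Terms $\vartheta(\varepsilon_{\Omega+1})$, relation $\prec$ and finite sets $E(\alpha)$ are defined by simultaneous recursion on term length: Terms: $\Omega$; $\vartheta\alpha$ for every term $\alpha$; $\langle\alpha_0,\dots,\alpha_{n-1}\rangle$ ($n\ge0$) for terms $\alpha_i$, provided that if $n>1$ then $\alpha_{n-1}\preceq\dots\preceq\alpha_0$ ($\preceq$ meaning $\prec$ or syntactic equality), and if $n=1$ then $\alpha_0$ is not of the form $\Omega$ or $\vartheta\beta$. $E(\Omega)=\emptyset$, $E(\vartheta\alpha)=\{\vartheta\alpha\}$, $E(\langle\alpha_0,\dots,\alpha_{n-1}\rangle)=\bigcup_{i<n}E(\alpha_i)$. $\alpha\prec\beta$ holds iff: (1) $\alpha=\Omega$ and $\beta=\langle\beta_0,\dots,\beta_{n-1}\rangle$ with $n>0$,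 $\Omega\preceq\beta_0$; or (2) $\alpha=\vartheta\alpha'$ and one of: $\beta=\Omega$; $\beta=\langle\beta_0,\dots,\beta_{n-1}\rangle$ with $n>0$, $\alpha\preceq\beta_0$; $\beta=\vartheta\beta'$ with $\alpha'\prec\beta'$ and $\gamma\prec\beta$ for all $\gamma\in E(\alpha')$; $\beta=\vartheta\beta'$ with $\alpha\preceq\gamma$ for some $\gamma\in E(\beta')$; or (3) $\alpha=\langle\alpha_0,\dots,\alpha_{m-1}\rangle$ and one of: $\beta$ is $\Omega$ or some $\vartheta\beta'$, and $m=0$ or $\alpha_0\prec\beta$; $\beta=\langle\beta_0,\dots,\beta_{n-1}\rangle$ and for some $j\le\min(m,n)$, $\alpha_i=\beta_i$ for all $i<j$ and either $j=m<n$ or ($j<\min(m,n)$ and $\alpha_j\prec\beta_j$). For terms $\alpha,\beta$, the set $C_\alpha(\beta)\subseteq\vartheta(\varepsilon_{\Omega+1})$ is the least set such that: $\Omega\in C_\alpha(\beta)$ and $\gamma\in C_\alpha(\beta)$ for all $\gamma\prec\beta$; if $\gamma\in C_\alpha(\beta)$ and $\gamma\prec\alpha$ then $\vartheta\gamma\in C_\alpha(\beta)$; if $\gamma_0,\dots,\gamma_{n-1}\in C_\alpha(\beta)$ and $\langle\gamma_0,\dots,\gamma_{n-1}\rangle$ is a term, then it lies in $C_\alpha(\beta)$. -}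

module Defs where

open import Data.List using (List; []; _∷_)
open import Data.List.Relation.Unary.All using (All)
open import Data.List.Relation.Unary.Any using (Any)
open import Data.Product using (_×_)
open import Data.Empty using (⊥)
open import Data.Unit using (⊤)
open import Relation.Binary.PropositionalEquality using (_≡_)

-- Raw terms (syntax of the notation system ϑ(ε_{Ω+1}) before the
-- well-formedness condition on tuples is imposed).
data Tm : Set where
  Ω   : Tm
  ϑ   : Tm → Tm
  ⟨_⟩ : List Tm → Tm

mutual
  E : Tm → List Tm
  E Ω       = []
  E (ϑ a)   = ϑ a ∷ []
  E ⟨ as ⟩  = Es as

  Es : List Tm → List Tm
  Es []       = []
  Es (a ∷ as) = appendE (E a) (Es as)

  appendE : List Tm → List Tm → List Tm
  appendE []       ys = ys
  appendE (x ∷ xs) ys = x ∷ appendE xs ys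

mutual
  data _≺_ : Tm → Tm → Set where
    Ω≺⟨⟩     : ∀ {b bs} → Ω ⪯ b → Ω ≺ ⟨ b ∷ bs ⟩
    ϑ≺Ω      : ∀ {a} → ϑ a ≺ Ω
    ϑ≺⟨⟩     : ∀ {a b bs} → ϑ a ⪯ b → ϑ a ≺ ⟨ b ∷ bs ⟩
    ϑ≺ϑ-arg  : ∀ {a b} → a ≺ b → All (λ g → g ≺ ϑ b) (E a) → ϑ a ≺ ϑ b
    ϑ≺ϑ-E    : ∀ {a b} → Any (λ g → ϑ a ⪯ g) (E b) → ϑ a ≺ ϑ b
    ⟨⟩≺Ω     : ⟨ [] ⟩ ≺ Ω
    ⟨∷⟩≺Ω    : ∀ {a as} → a ≺ Ω → ⟨ a ∷ as ⟩ ≺ Ω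
    ⟨⟩≺ϑ     : ∀ {b} → ⟨ [] ⟩ ≺ ϑ b
    ⟨∷⟩≺ϑ    : ∀ {a as b} → a ≺ ϑ b → ⟨ a ∷ as ⟩ ≺ ϑ b
    ⟨⟩≺⟨⟩    : ∀ {as bs} → as ≺L bs → ⟨ as ⟩ ≺ ⟨ bs ⟩

  data _⪯_ : Tm → Tm → Set where
    lt : ∀ {a b} → a ≺ b → a ⪯ b
    eq : ∀ {a b} → a ≡ b → a ⪯ b

  data _≺L_ : List Tm → List Tm → Set where
    []≺L   : ∀ {b bs} → [] ≺L (b ∷ bs)
    head≺L : ∀ {a as b bs} → a ≺ b → (a ∷ as) ≺L (b ∷ bs)
    tail≺L : ∀ {a as bs} → as ≺L bs → (a ∷ as) ≺L (a ∷ bs)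

data Decreasing : List Tm → Set where
  dec[]  : Decreasing []
  dec[_] : ∀ a → Decreasing (a ∷ [])
  dec∷   : ∀ {a b bs} → b ⪯ a → Decreasing (b ∷ bs) → Decreasing (a ∷ b ∷ bs)

SingletonOk : List Tm → Set
SingletonOk (Ω ∷ [])   = ⊥
SingletonOk (ϑ _ ∷ []) = ⊥
SingletonOk _          = ⊤

data IsTerm : Tm → Set where
  Ωt : IsTerm Ω
  ϑt : ∀ {a} → IsTerm a → IsTerm (ϑ a)
  ⟨⟩t : ∀ {as} → All IsTerm as → Decreasing as → SingletonOk as → IsTerm ⟨ as ⟩

data C (α β : Tm) : Tm → Set where
  CΩ   : C α β Ω
  C≺   : ∀ {g} → IsTerm g → g ≺ β → C α β g
  Cϑ   : ∀ {g} → C α β g → g ≺ α → C α β (ϑ g)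
  C⟨⟩  : ∀ {gs} → All (C α β) gs → IsTerm ⟨ gs ⟩ → C α β ⟨ gs ⟩

InSet : Tm → Tm → Set
InSet α γ = IsTerm γ × (∀ δ → C α γ δ → δ ≺ Ω → δ ≺ γ) × C α γ α

{-# OPTIONS --safe #-}
-- Every component of a tuple lies below the tuple, and E(γ) collects the ϑ-components
-- of γ; since C_α(β) is closed under forming tuples, membership of γ in C_α(β) is decided
-- by E(γ), the case γ ≺ β reducing to the fact that E(γ) lies below every bound of γ.
-- For the second part, ≺ is a strict total order. Every element of C_α(ϑα) below Ω lies
-- below ϑα, because each ϑ-component of such an element does. Conversely, let γ satisfy
-- the two conditions. A tuple γ ≺ Ω would lie in C_α(γ) and hence below itself, so
-- γ = ϑc unless Ω ⪯ γ. If c ≺ α then ϑc ∈ C_α(ϑc) is below Ω, again a contradiction;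
-- if α ≺ c then E(α) ⊆ C_α(ϑc) consists of ϑ-terms, so the Ω-condition puts E(α)
-- below ϑc and ϑα ≺ ϑc.
module Submission where

open import Defs
open import Data.Product using (_×_; _,_)
open import Data.List using (List; []; _∷_; _++_)
open import Data.List.Relation.Unary.All as All using (All; []; _∷_)
open import Data.List.Relation.Unary.All.Properties as All using ()
open import Data.List.Relation.Unary.Any as Any using (Any; here; there)
open import Data.List.Relation.Unary.Any.Properties as Any using ()
open import Data.Sum using (_⊎_; inj₁; inj₂)
open import Data.Empty using (⊥-elim)
open import Relation.Nullary using (¬_)
open import Relation.Binary.PropositionalEquality using (_≡_; refl; sym; cong)
open import Function.Bundles using (_⇔_; mk⇔)

appendE≡++ : ∀ xs ys → appendE xs ys ≡ xs ++ ys
appendE≡++ []       ys = refl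
appendE≡++ (x ∷ xs) ys = cong (x ∷_) (appendE≡++ xs ys)

module _ {P : Tm → Set} where

  All-appendE⁺ : ∀ {xs ys} → All P xs → All P ys → All P (appendE xs ys)
  All-appendE⁺ {xs} {ys} p q rewrite appendE≡++ xs ys = All.++⁺ p q

  All-appendE⁻ : ∀ xs {ys} → All P (appendE xs ys) → All P xs × All P ys
  All-appendE⁻ xs {ys} p rewrite appendE≡++ xs ys = All.++⁻ xs p

  Any-appendE⁺ˡ : ∀ {xs ys} → Any P xs → Any P (appendE xs ys)
  Any-appendE⁺ˡ {xs} {ys} p rewrite appendE≡++ xs ys = Any.++⁺ˡ p

  Any-appendE⁺ʳ : ∀ xs {ys} → Any P ys → Any P (appendE xs ys)
  Any-appendE⁺ʳ xs {ys} p rewrite appendE≡++ xs ys = Any.++⁺ʳ xs p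

data Isϑ : Tm → Set where
  ϑ-form : ∀ a → Isϑ (ϑ a)

mutual
  E-Isϑ : ∀ a → All Isϑ (E a)
  E-Isϑ Ω      = []
  E-Isϑ (ϑ a)  = ϑ-form a ∷ []
  E-Isϑ ⟨ as ⟩ = Es-Isϑ as

  Es-Isϑ : ∀ as → All Isϑ (Es as)
  Es-Isϑ []       = []
  Es-Isϑ (a ∷ as) = All-appendE⁺ (E-Isϑ a) (Es-Isϑ as)

mutual
  E-IsTerm : ∀ {x} → IsTerm x → All IsTerm (E x)
  E-IsTerm Ωt           = []
  E-IsTerm (ϑt t)       = ϑt t ∷ []
  E-IsTerm (⟨⟩t ts _ _) = Es-IsTerm ts

  Es-IsTerm : ∀ {as} → All IsTerm as → All IsTerm (Es as)
  Es-IsTerm []       = []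
  Es-IsTerm (t ∷ ts) = All-appendE⁺ (E-IsTerm t) (Es-IsTerm ts)

mutual
  ≺-trans : ∀ {x y z} → x ≺ y → y ≺ z → x ≺ z
  ≺-trans (Ω≺⟨⟩ e) (⟨∷⟩≺Ω r) with () ← ⪯-≺-trans e r
  ≺-trans (Ω≺⟨⟩ e) (⟨∷⟩≺ϑ r) with () ← ⪯-≺-trans e r
  ≺-trans (Ω≺⟨⟩ e) (⟨⟩≺⟨⟩ (head≺L r)) = Ω≺⟨⟩ (lt (⪯-≺-trans e r))
  ≺-trans (Ω≺⟨⟩ e) (⟨⟩≺⟨⟩ (tail≺L _)) = Ω≺⟨⟩ e
  ≺-trans ϑ≺Ω (Ω≺⟨⟩ e) = ϑ≺⟨⟩ (lt (≺-⪯-trans ϑ≺Ω e))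
  ≺-trans (ϑ≺⟨⟩ e) (⟨∷⟩≺Ω r) = ϑ≺Ω
  ≺-trans (ϑ≺⟨⟩ e) (⟨∷⟩≺ϑ r) = ⪯-≺-trans e r
  ≺-trans (ϑ≺⟨⟩ e) (⟨⟩≺⟨⟩ (head≺L r)) = ϑ≺⟨⟩ (lt (⪯-≺-trans e r))
  ≺-trans (ϑ≺⟨⟩ e) (⟨⟩≺⟨⟩ (tail≺L _)) = ϑ≺⟨⟩ e
  ≺-trans (ϑ≺ϑ-arg r A) ϑ≺Ω = ϑ≺Ω
  ≺-trans p@(ϑ≺ϑ-arg _ _) (ϑ≺⟨⟩ e) = ϑ≺⟨⟩ (lt (≺-⪯-trans p e))
  ≺-trans (ϑ≺ϑ-arg r A) q@(ϑ≺ϑ-arg r′ _) = ϑ≺ϑ-arg (≺-trans r r′) (All≺-trans A q)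
  ≺-trans p@(ϑ≺ϑ-arg _ _) (ϑ≺ϑ-E an) = ϑ≺ϑ-E (Any⪰-trans p an)
  ≺-trans (ϑ≺ϑ-E an) ϑ≺Ω = ϑ≺Ω
  ≺-trans p@(ϑ≺ϑ-E _) (ϑ≺⟨⟩ e) = ϑ≺⟨⟩ (lt (≺-⪯-trans p e))
  ≺-trans (ϑ≺ϑ-E an) (ϑ≺ϑ-arg _ A) = Any⪰-All≺⇒≺ an A
  ≺-trans p@(ϑ≺ϑ-E _) (ϑ≺ϑ-E an) = ϑ≺ϑ-E (Any⪰-trans p an)
  ≺-trans ⟨⟩≺Ω (Ω≺⟨⟩ _) = ⟨⟩≺⟨⟩ []≺L
  ≺-trans (⟨∷⟩≺Ω r) (Ω≺⟨⟩ e) = ⟨⟩≺⟨⟩ (head≺L (≺-⪯-trans r e))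
  ≺-trans ⟨⟩≺ϑ ϑ≺Ω = ⟨⟩≺Ω
  ≺-trans ⟨⟩≺ϑ (ϑ≺⟨⟩ _) = ⟨⟩≺⟨⟩ []≺L
  ≺-trans ⟨⟩≺ϑ (ϑ≺ϑ-arg _ _) = ⟨⟩≺ϑ
  ≺-trans ⟨⟩≺ϑ (ϑ≺ϑ-E _) = ⟨⟩≺ϑ
  ≺-trans (⟨∷⟩≺ϑ r) q@ϑ≺Ω = ⟨∷⟩≺Ω (≺-trans r q)
  ≺-trans (⟨∷⟩≺ϑ r) (ϑ≺⟨⟩ e) = ⟨⟩≺⟨⟩ (head≺L (≺-⪯-trans r e))
  ≺-trans (⟨∷⟩≺ϑ r) q@(ϑ≺ϑ-arg _ _) = ⟨∷⟩≺ϑ (≺-trans r q)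
  ≺-trans (⟨∷⟩≺ϑ r) q@(ϑ≺ϑ-E _) = ⟨∷⟩≺ϑ (≺-trans r q)
  ≺-trans (⟨⟩≺⟨⟩ []≺L) (⟨∷⟩≺Ω r) = ⟨⟩≺Ω
  ≺-trans (⟨⟩≺⟨⟩ (head≺L r′)) (⟨∷⟩≺Ω r) = ⟨∷⟩≺Ω (≺-trans r′ r)
  ≺-trans (⟨⟩≺⟨⟩ (tail≺L _)) (⟨∷⟩≺Ω r) = ⟨∷⟩≺Ω r
  ≺-trans (⟨⟩≺⟨⟩ []≺L) (⟨∷⟩≺ϑ r) = ⟨⟩≺ϑ
  ≺-trans (⟨⟩≺⟨⟩ (head≺L r′)) (⟨∷⟩≺ϑ r) = ⟨∷⟩≺ϑ (≺-trans r′ r)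
  ≺-trans (⟨⟩≺⟨⟩ (tail≺L _)) (⟨∷⟩≺ϑ r) = ⟨∷⟩≺ϑ r
  ≺-trans (⟨⟩≺⟨⟩ L) (⟨⟩≺⟨⟩ L′) = ⟨⟩≺⟨⟩ (≺L-trans L L′)

  ≺L-trans : ∀ {xs ys zs} → xs ≺L ys → ys ≺L zs → xs ≺L zs
  ≺L-trans []≺L       (head≺L _)  = []≺L
  ≺L-trans []≺L       (tail≺L _)  = []≺L
  ≺L-trans (head≺L r) (head≺L r′) = head≺L (≺-trans r r′)
  ≺L-trans (head≺L r) (tail≺L _)  = head≺L r
  ≺L-trans (tail≺L _) (head≺L r′) = head≺L r′
  ≺L-trans (tail≺L L) (tail≺L L′) = tail≺L (≺L-trans L L′)

  ⪯-≺-trans : ∀ {x y z} → x ⪯ y → y ≺ z → x ≺ z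
  ⪯-≺-trans (lt p)    q = ≺-trans p q
  ⪯-≺-trans (eq refl) q = q

  ≺-⪯-trans : ∀ {x y z} → x ≺ y → y ⪯ z → x ≺ z
  ≺-⪯-trans p (lt q)    = ≺-trans p q
  ≺-⪯-trans p (eq refl) = p

  All≺-trans : ∀ {y z es} → All (_≺ y) es → y ≺ z → All (_≺ z) es
  All≺-trans []       q = []
  All≺-trans (p ∷ ps) q = ≺-trans p q ∷ All≺-trans ps q

  Any⪰-trans : ∀ {x y es} → x ≺ y → Any (y ⪯_) es → Any (x ⪯_) es
  Any⪰-trans p (here e)  = here (lt (≺-⪯-trans p e))
  Any⪰-trans p (there a) = there (Any⪰-trans p a)

  Any⪰-All≺⇒≺ : ∀ {x z es} → Any (x ⪯_) es → All (_≺ z) es → x ≺ z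
  Any⪰-All≺⇒≺ (here e)  (r ∷ _)  = ⪯-≺-trans e r
  Any⪰-All≺⇒≺ (there a) (_ ∷ rs) = Any⪰-All≺⇒≺ a rs

data Trichotomous {A : Set} (_<_ : A → A → Set) (x y : A) : Set where
  tri< : x < y → Trichotomous _<_ x y
  tri≈ : x ≡ y → Trichotomous _<_ x y
  tri> : y < x → Trichotomous _<_ x y

mutual
  ≺-cmp : ∀ x y → Trichotomous _≺_ x y
  ≺-cmp Ω Ω = tri≈ refl
  ≺-cmp Ω (ϑ b) = tri> ϑ≺Ω
  ≺-cmp Ω ⟨ [] ⟩ = tri> ⟨⟩≺Ω
  ≺-cmp Ω ⟨ b ∷ bs ⟩ with ≺-cmp Ω b
  ... | tri< p = tri< (Ω≺⟨⟩ (lt p))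
  ... | tri≈ p = tri< (Ω≺⟨⟩ (eq p))
  ... | tri> p = tri> (⟨∷⟩≺Ω p)
  ≺-cmp (ϑ a) Ω = tri< ϑ≺Ω
  ≺-cmp (ϑ a) ⟨ [] ⟩ = tri> ⟨⟩≺ϑ
  ≺-cmp (ϑ a) ⟨ b ∷ bs ⟩ with ≺-cmp (ϑ a) b
  ... | tri< p = tri< (ϑ≺⟨⟩ (lt p))
  ... | tri≈ p = tri< (ϑ≺⟨⟩ (eq p))
  ... | tri> p = tri> (⟨∷⟩≺ϑ p)
  ≺-cmp (ϑ a) (ϑ b) with ≺-cmp a b
  ... | tri≈ refl = tri≈ refl
  ... | tri< p with E-All≺⊎Any⪰ a (ϑ b)
  ...   | inj₁ A  = tri< (ϑ≺ϑ-arg p A)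
  ...   | inj₂ an = tri> (ϑ≺ϑ-E an)
  ≺-cmp (ϑ a) (ϑ b) | tri> p with E-All≺⊎Any⪰ b (ϑ a)
  ...   | inj₁ A  = tri> (ϑ≺ϑ-arg p A)
  ...   | inj₂ an = tri< (ϑ≺ϑ-E an)
  ≺-cmp ⟨ [] ⟩ Ω = tri< ⟨⟩≺Ω
  ≺-cmp ⟨ a ∷ as ⟩ Ω with ≺-cmp a Ω
  ... | tri< p = tri< (⟨∷⟩≺Ω p)
  ... | tri≈ p = tri> (Ω≺⟨⟩ (eq (sym p)))
  ... | tri> p = tri> (Ω≺⟨⟩ (lt p))
  ≺-cmp ⟨ [] ⟩ (ϑ b) = tri< ⟨⟩≺ϑ
  ≺-cmp ⟨ a ∷ as ⟩ (ϑ b) with ≺-cmp a (ϑ b)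
  ... | tri< p = tri< (⟨∷⟩≺ϑ p)
  ... | tri≈ p = tri> (ϑ≺⟨⟩ (eq (sym p)))
  ... | tri> p = tri> (ϑ≺⟨⟩ (lt p))
  ≺-cmp ⟨ as ⟩ ⟨ bs ⟩ with ≺L-cmp as bs
  ... | tri< L    = tri< (⟨⟩≺⟨⟩ L)
  ... | tri≈ refl = tri≈ refl
  ... | tri> L    = tri> (⟨⟩≺⟨⟩ L)

  ≺L-cmp : ∀ xs ys → Trichotomous _≺L_ xs ys
  ≺L-cmp []       []       = tri≈ refl
  ≺L-cmp []       (b ∷ bs) = tri< []≺L
  ≺L-cmp (a ∷ as) []       = tri> []≺L
  ≺L-cmp (a ∷ as) (b ∷ bs) with ≺-cmp a b
  ... | tri< p = tri< (head≺L p)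
  ... | tri> p = tri> (head≺L p)
  ... | tri≈ refl with ≺L-cmp as bs
  ...   | tri< L    = tri< (tail≺L L)
  ...   | tri≈ refl = tri≈ refl
  ...   | tri> L    = tri> (tail≺L L)

  E-All≺⊎Any⪰ : ∀ a y → All (_≺ y) (E a) ⊎ Any (y ⪯_) (E a)
  E-All≺⊎Any⪰ Ω      y = inj₁ []
  E-All≺⊎Any⪰ (ϑ a)  y with ≺-cmp (ϑ a) y
  ... | tri< p = inj₁ (p ∷ [])
  ... | tri≈ p = inj₂ (here (eq (sym p)))
  ... | tri> p = inj₂ (here (lt p))
  E-All≺⊎Any⪰ ⟨ as ⟩ y = Es-All≺⊎Any⪰ as y

  Es-All≺⊎Any⪰ : ∀ as y → All (_≺ y) (Es as) ⊎ Any (y ⪯_) (Es as)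
  Es-All≺⊎Any⪰ []       y = inj₁ []
  Es-All≺⊎Any⪰ (a ∷ as) y with E-All≺⊎Any⪰ a y | Es-All≺⊎Any⪰ as y
  ... | inj₁ A | inj₁ B = inj₁ (All-appendE⁺ A B)
  ... | inj₂ X | _      = inj₂ (Any-appendE⁺ˡ X)
  ... | inj₁ _ | inj₂ Y = inj₂ (Any-appendE⁺ʳ (E a) Y)

E≺ϑ : ∀ a → All (_≺ ϑ a) (E a)
E≺ϑ a = All.tabulate λ g∈ → below (All.lookup (E-Isϑ a) g∈) (Any.map eq g∈)
  where
  below : ∀ {g} → Isϑ g → Any (g ⪯_) (E a) → g ≺ ϑ a
  below (ϑ-form _) = ϑ≺ϑ-E

mutual
  ≺-irrefl : ∀ x → ¬ x ≺ x
  ≺-irrefl (ϑ a)  (ϑ≺ϑ-arg r _) = ≺-irrefl a r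
  ≺-irrefl (ϑ a)  (ϑ≺ϑ-E an) with All.lookupAny (All.zip (E-≺-irrefl a , E≺ϑ a)) an
  ... | (g≮g , g≺ϑa) , ϑa⪯g = g≮g (≺-⪯-trans g≺ϑa ϑa⪯g)
  ≺-irrefl ⟨ as ⟩ (⟨⟩≺⟨⟩ L) = ≺L-irrefl as L

  ≺L-irrefl : ∀ xs → ¬ xs ≺L xs
  ≺L-irrefl (a ∷ as) (head≺L r) = ≺-irrefl a r
  ≺L-irrefl (a ∷ as) (tail≺L L) = ≺L-irrefl as L

  E-≺-irrefl : ∀ a → All (λ g → ¬ g ≺ g) (E a)
  E-≺-irrefl Ω      = []
  E-≺-irrefl (ϑ a)  = ≺-irrefl (ϑ a) ∷ []
  E-≺-irrefl ⟨ as ⟩ = Es-≺-irrefl as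

  Es-≺-irrefl : ∀ as → All (λ g → ¬ g ≺ g) (Es as)
  Es-≺-irrefl []       = []
  Es-≺-irrefl (a ∷ as) = All-appendE⁺ (E-≺-irrefl a) (Es-≺-irrefl as)

head≺tuple : ∀ a as → a ≺ ⟨ a ∷ as ⟩
head≺tuple Ω          as = Ω≺⟨⟩ (eq refl)
head≺tuple (ϑ a)      as = ϑ≺⟨⟩ (eq refl)
head≺tuple ⟨ [] ⟩     as = ⟨⟩≺⟨⟩ []≺L
head≺tuple ⟨ b ∷ bs ⟩ as = ⟨⟩≺⟨⟩ (head≺L (head≺tuple b bs))

mutual
  E-≺ : ∀ {x z} → IsTerm x → x ≺ z → All (_≺ z) (E x)
  E-≺ Ωt     _ = []
  E-≺ (ϑt _) p = p ∷ []
  E-≺ (⟨⟩t {[]}     _  _ _) _ = []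
  E-≺ (⟨⟩t {a ∷ as} ts d _) p = Es-≺ ts d (≺-trans (head≺tuple a as) p)

  -- A decreasing tuple is bounded by its head, so the bound propagates along it.
  Es-≺ : ∀ {a as z} → All IsTerm (a ∷ as) → Decreasing (a ∷ as) → a ≺ z →
         All (_≺ z) (Es (a ∷ as))
  Es-≺ (t ∷ [])  dec[ _ ]     p = All-appendE⁺ (E-≺ t p) []
  Es-≺ (t ∷ ts) (dec∷ b⪯a d) p = All-appendE⁺ (E-≺ t p) (Es-≺ ts d (⪯-≺-trans b⪯a p))

C-below : ∀ {α β es} → All IsTerm es → All (_≺ β) es → All (C α β) es
C-below []       []       = []
C-below (t ∷ ts) (p ∷ ps) = C≺ t p ∷ C-below ts ps

mutual
  C⇒All-C-E : ∀ {α β g} → C α β g → All (C α β) (E g)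
  C⇒All-C-E CΩ          = []
  C⇒All-C-E (C≺ t p)    = C-below (E-IsTerm t) (E-≺ t p)
  C⇒All-C-E (Cϑ d p)    = Cϑ d p ∷ []
  C⇒All-C-E (C⟨⟩ ds _)  = All-C⇒All-C-Es ds

  All-C⇒All-C-Es : ∀ {α β gs} → All (C α β) gs → All (C α β) (Es gs)
  All-C⇒All-C-Es []       = []
  All-C⇒All-C-Es (d ∷ ds) = All-appendE⁺ (C⇒All-C-E d) (All-C⇒All-C-Es ds)

mutual
  All-C-E⇒C : ∀ {α β g} → IsTerm g → All (C α β) (E g) → C α β g
  All-C-E⇒C Ωt            _        = CΩ
  All-C-E⇒C (ϑt _)        (c ∷ []) = c
  All-C-E⇒C t@(⟨⟩t ts _ _) A       = C⟨⟩ (All-C-Es⇒All-C ts A) t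

  All-C-Es⇒All-C : ∀ {α β gs} → All IsTerm gs → All (C α β) (Es gs) → All (C α β) gs
  All-C-Es⇒All-C                  []       _ = []
  All-C-Es⇒All-C {gs = g ∷ _} (t ∷ ts) A with All-appendE⁻ (E g) A
  ... | Ag , Ags = All-C-E⇒C t Ag ∷ All-C-Es⇒All-C ts Ags

C-of-E≺ : ∀ {α β γ} → IsTerm γ → All (_≺ β) (E γ) → C α β γ
C-of-E≺ t E≺β = All-C-E⇒C t (C-below (E-IsTerm t) E≺β)

C-ϑ-self : ∀ {α c} → IsTerm c → C α (ϑ c) c
C-ϑ-self {c = c} t = C-of-E≺ t (E≺ϑ c)

C-tuple-self : ∀ {α gs} → IsTerm ⟨ gs ⟩ → C α ⟨ gs ⟩ ⟨ gs ⟩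
C-tuple-self t@(⟨⟩t {[]}     _  _ _) = C⟨⟩ [] t
C-tuple-self t@(⟨⟩t {g ∷ gs} ts d _) = C-of-E≺ t (Es-≺ ts d (head≺tuple g gs))

mutual
  C-ϑ-E≺ϑ : ∀ {α δ} → C α (ϑ α) δ → All (_≺ ϑ α) (E δ)
  C-ϑ-E≺ϑ CΩ          = []
  C-ϑ-E≺ϑ (C≺ t p)    = E-≺ t p
  C-ϑ-E≺ϑ (Cϑ d p)    = ϑ≺ϑ-arg p (C-ϑ-E≺ϑ d) ∷ []
  C-ϑ-E≺ϑ (C⟨⟩ ds _)  = All-C-ϑ-Es≺ϑ ds

  All-C-ϑ-Es≺ϑ : ∀ {α gs} → All (C α (ϑ α)) gs → All (_≺ ϑ α) (Es gs)
  All-C-ϑ-Es≺ϑ []       = []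
  All-C-ϑ-Es≺ϑ (d ∷ ds) = All-appendE⁺ (C-ϑ-E≺ϑ d) (All-C-ϑ-Es≺ϑ ds)

C-ϑ-≺Ω⇒≺ϑ : ∀ {α δ} → C α (ϑ α) δ → δ ≺ Ω → δ ≺ ϑ α
C-ϑ-≺Ω⇒≺ϑ (C≺ _ p)          _         = p
C-ϑ-≺Ω⇒≺ϑ (Cϑ d p)          _         = ϑ≺ϑ-arg p (C-ϑ-E≺ϑ d)
C-ϑ-≺Ω⇒≺ϑ (C⟨⟩ []       _)  _         = ⟨⟩≺ϑ
C-ϑ-≺Ω⇒≺ϑ (C⟨⟩ (d ∷ _)  _)  (⟨∷⟩≺Ω r) = ⟨∷⟩≺ϑ (C-ϑ-≺Ω⇒≺ϑ d r)

ϑ-InSet : ∀ {α} → IsTerm α → InSet α (ϑ α)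
ϑ-InSet t = ϑt t , (λ _ → C-ϑ-≺Ω⇒≺ϑ) , C-ϑ-self t

Ω-bounded⇒E≺ : ∀ {α γ x} → (∀ δ → C α γ δ → δ ≺ Ω → δ ≺ γ) → C α γ x → All (_≺ γ) (E x)
Ω-bounded⇒E≺ {α} {γ} {x} H c = All.zipWith below (C⇒All-C-E c , E-Isϑ x)
  where
  below : ∀ {g} → C α γ g × Isϑ g → g ≺ γ
  below (cg , ϑ-form _) = H _ cg ϑ≺Ω

ϑ-InSet-minimal : ∀ α γ → InSet α γ → ϑ α ⪯ γ
ϑ-InSet-minimal α Ω _ = lt ϑ≺Ω
ϑ-InSet-minimal α (ϑ c) (ϑt t , H , α∈C) with ≺-cmp α c
... | tri< α≺c  = lt (ϑ≺ϑ-arg α≺c (Ω-bounded⇒E≺ H α∈C))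
... | tri≈ refl = eq refl
... | tri> c≺α  = ⊥-elim (≺-irrefl (ϑ c) (H (ϑ c) (Cϑ (C-ϑ-self t) c≺α) ϑ≺Ω))
ϑ-InSet-minimal α ⟨ gs ⟩ (t , H , _) with ≺-cmp ⟨ gs ⟩ Ω
... | tri< γ≺Ω = ⊥-elim (≺-irrefl ⟨ gs ⟩ (H ⟨ gs ⟩ (C-tuple-self t) γ≺Ω))
... | tri> Ω≺γ = lt (≺-trans ϑ≺Ω Ω≺γ)

proposition3p9 : ((α β γ : Tm) → IsTerm α → IsTerm β → IsTerm γ → (C α β γ ⇔ All (C α β) (E γ))) × ((α : Tm) → IsTerm α → InSet α (ϑ α) × ((γ : Tm) → InSet α γ → ϑ α ⪯ γ))
proposition3p9 = (λ α β γ _ _ tγ → mk⇔ C⇒All-C-E (All-C-E⇒C tγ))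
               , (λ α tα → ϑ-InSet tα , ϑ-InSet-minimal α)
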